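{- Let $G=(V,E)$ be a graph, let $X$ be a reconfiguration monotone increasing property of vertex sets of $G$, and let $A_s,A_t\subseteq V$ have property $X$ with $|A_s|=|A_t|=k$. Then there exists an $X$-TJ sequence from $A_s$ to $A_t$ of length at most $\ell$ if and only if there exists an $X$-TAR sequence from $A_s$ to $A_t$ with threshold $k+1$ of length at most $2\ell$.
   Context: For $A,B\subseteq V$: $B$ is obtained from $A$ by a token jumping (TJ) step if $|A|=|B|$ and $|A\setminus B|=1$; by a token addition/removal (TAR) step if one of $A,B$ is obtained from the other by adding exactly one vertex. For a property $X$ of vertex sets and $Y\in\{\text{TJ},\text{TAR}\}$, an $X$-$Y$ sequence from $A$ to $B$ is a sequence $A=A_1,\dots,A_m=B$ of sets with property $X$ such that each $A_{i+1}$ is obtained from $A_i$ by a $Y$ step; its length is $m$. A TAR sequence has threshold $t$ if $|A_i|\le t$ for all $i$. A property $X$ is reconfiguration monotone increasing if for all $A,B$ with property $X$ such that $B$ is obtained from $A$ by a TJ step, and $v\in B\setminus A$, the set $A\cup\{v\}$ also has property $X$. -}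

module Defs where

open import Data.Nat using (ℕ; zero; suc; _≤_; _+_; _*_)
open import Data.Fin using (Fin)
open import Data.Fin.Subset using (Subset; _∪_; _─_; ⁅_⁆; ∣_∣; _∈_; _∉_)
open import Data.Product using (Σ; _×_)
open import Relation.Binary.PropositionalEquality using (_≡_)

-- A (simple, finite) graph on vertex set Fin n, given by its edge relation.
-- (The graph only serves as the ambient structure; the property X is an
-- arbitrary property of vertex sets.)
record Graph (n : ℕ) : Set₁ where
  field
    Adj : Fin n → Fin n → Set

TJStep : ∀ {n} → Subset n → Subset n → Set
TJStep A B = (∣ A ∣ ≡ ∣ B ∣) × (∣ A ─ B ∣ ≡ 1)

AddOne : ∀ {n} → Subset n → Subset n → Set
AddOne {n} A B = Σ (Fin n) λ v → (v ∉ A) × (B ≡ A ∪ ⁅ v ⁆)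

data TARStep {n : ℕ} (A B : Subset n) : Set where
  add    : AddOne A B → TARStep A B
  remove : AddOne B A → TARStep A B

-- Seq R P A B m : a sequence A = A₁, …, Aₘ = B of sets satisfying P, with
-- consecutive sets related by R; m is its length (number of sets).
data Seq {n : ℕ} (R : Subset n → Subset n → Set) (P : Subset n → Set)
         : Subset n → Subset n → ℕ → Set where
  single : ∀ {A} → P A → Seq R P A A 1
  step   : ∀ {A B C m} → P A → R A B → Seq R P B C m → Seq R P A C (suc m)

TJSeq : ∀ {n} → (Subset n → Set) → Subset n → Subset n → ℕ → Set
TJSeq X = Seq TJStep X

TARSeq : ∀ {n} → (Subset n → Set) → ℕ → Subset n → Subset n → ℕ → Set
TARSeq X t = Seq TARStep (λ S → X S × (∣ S ∣ ≤ t))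

MonotoneIncreasing : ∀ {n} → (Subset n → Set) → Set
MonotoneIncreasing {n} X =
  ∀ (A B : Subset n) → X A → X B → TJStep A B →
  ∀ (v : Fin n) → v ∈ B → v ∉ A → X (A ∪ ⁅ v ⁆)

{-# OPTIONS --safe #-}
-- A token jump from x to y is simulated by adding y and then removing x; the
-- intermediate set has property X by monotonicity.  Conversely, in a TAR
-- sequence between k-sets with threshold k + 1, an addition followed by a
-- removal amounts to at most one token jump, while an excursion below size k
-- is turned, recursively, into a TJ sequence of (k - 1)-sets, which is then
-- lifted to k-sets by carrying the removed token along (again using
-- monotonicity).  Each jump produced costs at least two TAR steps.
module Submission where

open import Data.Nat using (ℕ; zero; suc; _+_; _*_; _≤_; _<_; s≤s; z≤n)
open import Data.Nat.Properties
  using ( suc-injective; +-comm; +-suc; +-cancelʳ-≡; +-mono-≤; +-monoʳ-≤; +-monoʳ-<; *-suc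
        ; *-monoʳ-≤; *-cancelˡ-<; ≤-refl; ≤-reflexive; ≤-trans; ≤-<-trans; <-≤-trans; <⇒≤; <⇒≢
        ; ≤∧≢⇒<; m≤n⇒m≤1+n; m≤n⇒m<n∨m≡n; n<1⇒n≡0; n≤1+n; m≤m+n; m≤n+m; 1+n≢0; 1+n≢n; 1+n≰n
        ; _≟_; module ≤-Reasoning)
open import Data.Nat.Induction using (<-wellFounded)
open import Data.Nat.Tactic.RingSolver using (solve-∀)
open import Data.Fin using (Fin; zero; suc)
open import Data.Fin.Subset
  using (Subset; inside; outside; ⊥; ⁅_⁆; _∪_; _∩_; _─_; ∣_∣; _∈_; _∉_; _⊆_)
open import Data.Fin.Subset.Properties
  using ( _∈?_; ∉⊥; x∈⁅x⁆; ∣⁅x⁆∣≡1; ⊆-antisym; p⊆q⇒∣p∣≤∣q∣; ∪-identityʳ; ∪-comm; ∩-comm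
        ; p⊆p∪q; x∈p∪q⁺; x∈p∪q⁻; x∈p∧x∉q⇒x∈p─q; p─q⊆p; drop-not-there)
open import Data.Vec using ([]; _∷_; here; there)
open import Data.Product using (Σ; ∃-syntax; _×_; _,_; proj₁; proj₂; map₁; map₂)
open import Data.Sum using (inj₁; inj₂)
import Data.Sum as Sum
open import Function using (_∘_)
open import Function.Bundles using (_⇔_; mk⇔)
open import Induction.WellFounded using (Acc; acc)
open import Relation.Nullary using (yes; no; contradiction)
open import Relation.Binary.PropositionalEquality
  using (_≡_; refl; sym; trans; cong; subst; module ≡-Reasoning)
open import Relation.Binary.Construct.Closure.Reflexive as Refl using (ReflClosure; [_])
open import Defs

private
  variable
    n j k m t : ℕ
    x y : Fin n
    p q A B C S T : Subset n
    R : Subset n → Subset n → Set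
    P : Subset n → Set

x∉p⇒∣p∪⁅x⁆∣≡1+∣p∣ : ∀ (p : Subset n) → x ∉ p → ∣ p ∪ ⁅ x ⁆ ∣ ≡ suc ∣ p ∣
x∉p⇒∣p∪⁅x⁆∣≡1+∣p∣ {x = zero}  (inside  ∷ p) x∉p = contradiction here x∉p
x∉p⇒∣p∪⁅x⁆∣≡1+∣p∣ {x = zero}  (outside ∷ p) _   = cong (suc ∘ ∣_∣) (∪-identityʳ p)
x∉p⇒∣p∪⁅x⁆∣≡1+∣p∣ {x = suc x} (inside  ∷ p) x∉p = cong suc (x∉p⇒∣p∪⁅x⁆∣≡1+∣p∣ p (drop-not-there x∉p))
x∉p⇒∣p∪⁅x⁆∣≡1+∣p∣ {x = suc x} (outside ∷ p) x∉p = x∉p⇒∣p∪⁅x⁆∣≡1+∣p∣ p (drop-not-there x∉p)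

∣p∣≡0⇒p≡⊥ : ∣ p ∣ ≡ 0 → p ≡ ⊥
∣p∣≡0⇒p≡⊥ {p = []}          _     = refl
∣p∣≡0⇒p≡⊥ {p = outside ∷ p} ∣p∣≡0 = cong (outside ∷_) (∣p∣≡0⇒p≡⊥ ∣p∣≡0)
∣p∣≡0⇒p≡⊥ {p = inside  ∷ p} ()

∣p∣≡1⇒p≡⁅x⁆ : ∣ p ∣ ≡ 1 → ∃[ x ] p ≡ ⁅ x ⁆
∣p∣≡1⇒p≡⁅x⁆ {p = inside  ∷ p} ∣p∣≡1 = zero , cong (inside ∷_) (∣p∣≡0⇒p≡⊥ (suc-injective ∣p∣≡1))
∣p∣≡1⇒p≡⁅x⁆ {p = outside ∷ p} ∣p∣≡1 with ∣p∣≡1⇒p≡⁅x⁆ ∣p∣≡1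
... | x , p≡⁅x⁆ = suc x , cong (outside ∷_) p≡⁅x⁆
∣p∣≡1⇒p≡⁅x⁆ {p = []}          ()

∣p∣≡∣p─q∣+∣p∩q∣ : ∀ (p q : Subset n) → ∣ p ∣ ≡ ∣ p ─ q ∣ + ∣ p ∩ q ∣
∣p∣≡∣p─q∣+∣p∩q∣ []            []            = refl
∣p∣≡∣p─q∣+∣p∩q∣ (inside  ∷ p) (inside  ∷ q) = trans (cong suc (∣p∣≡∣p─q∣+∣p∩q∣ p q)) (sym (+-suc _ _))
∣p∣≡∣p─q∣+∣p∩q∣ (inside  ∷ p) (outside ∷ q) = cong suc (∣p∣≡∣p─q∣+∣p∩q∣ p q)
∣p∣≡∣p─q∣+∣p∩q∣ (outside ∷ p) (inside  ∷ q) = ∣p∣≡∣p─q∣+∣p∩q∣ p q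
∣p∣≡∣p─q∣+∣p∩q∣ (outside ∷ p) (outside ∷ q) = ∣p∣≡∣p─q∣+∣p∩q∣ p q

∣p∣≡∣q∣⇒∣p─q∣≡∣q─p∣ : ∀ (p q : Subset n) → ∣ p ∣ ≡ ∣ q ∣ → ∣ p ─ q ∣ ≡ ∣ q ─ p ∣
∣p∣≡∣q∣⇒∣p─q∣≡∣q─p∣ p q ∣p∣≡∣q∣ = +-cancelʳ-≡ ∣ p ∩ q ∣ _ _ (begin
  ∣ p ─ q ∣ + ∣ p ∩ q ∣ ≡⟨ sym (∣p∣≡∣p─q∣+∣p∩q∣ p q) ⟩
  ∣ p ∣                 ≡⟨ ∣p∣≡∣q∣ ⟩
  ∣ q ∣                 ≡⟨ ∣p∣≡∣p─q∣+∣p∩q∣ q p ⟩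
  ∣ q ─ p ∣ + ∣ q ∩ p ∣ ≡⟨ cong (λ r → ∣ q ─ p ∣ + ∣ r ∣) (∩-comm q p) ⟩
  ∣ q ─ p ∣ + ∣ p ∩ q ∣ ∎)
  where open ≡-Reasoning

x∈p─q⇒x∉q : ∀ (p q : Subset n) → x ∈ p ─ q → x ∉ q
x∈p─q⇒x∉q (inside ∷ p) (outside ∷ q) here           ()
x∈p─q⇒x∉q (_      ∷ p) (_       ∷ q) (there x∈p─q) (there x∈q) = x∈p─q⇒x∉q p q x∈p─q x∈q

p∪[q─p]≡p∪q : ∀ (p q : Subset n) → p ∪ (q ─ p) ≡ p ∪ q
p∪[q─p]≡p∪q []            []      = refl
p∪[q─p]≡p∪q (inside  ∷ p) (_ ∷ q) = cong (inside ∷_) (p∪[q─p]≡p∪q p q)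
p∪[q─p]≡p∪q (outside ∷ p) (s ∷ q) = cong (s ∷_) (p∪[q─p]≡p∪q p q)

∣p─q∣≡0⇒p⊆q : ∀ (p q : Subset n) → ∣ p ─ q ∣ ≡ 0 → p ⊆ q
∣p─q∣≡0⇒p⊆q p q ∣p─q∣≡0 {x} x∈p with x ∈? q
... | yes x∈q = x∈q
... | no  x∉q = contradiction (subst (x ∈_) (∣p∣≡0⇒p≡⊥ ∣p─q∣≡0) (x∈p∧x∉q⇒x∈p─q x∈p x∉q)) ∉⊥

p⊆q∪⁅x⁆⇒∣p─q∣≤1 : p ⊆ q ∪ ⁅ x ⁆ → ∣ p ─ q ∣ ≤ 1
p⊆q∪⁅x⁆⇒∣p─q∣≤1 {p = p} {q} {x} p⊆q∪x = subst (∣ p ─ q ∣ ≤_) (∣⁅x⁆∣≡1 x) (p⊆q⇒∣p∣≤∣q∣ p─q⊆⁅x⁆)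
  where
  p─q⊆⁅x⁆ : p ─ q ⊆ ⁅ x ⁆
  p─q⊆⁅x⁆ z∈p─q with x∈p∪q⁻ q ⁅ x ⁆ (p⊆q∪x (p─q⊆p p q z∈p─q))
  ... | inj₁ z∈q   = contradiction z∈q (x∈p─q⇒x∉q p q z∈p─q)
  ... | inj₂ z∈⁅x⁆ = z∈⁅x⁆

TJStep⁼ : Subset n → Subset n → Set
TJStep⁼ = ReflClosure TJStep

p⊆q∪⁅x⁆⇒TJStep⁼ : ∣ p ∣ ≡ ∣ q ∣ → p ⊆ q ∪ ⁅ x ⁆ → TJStep⁼ p q
p⊆q∪⁅x⁆⇒TJStep⁼ {p = p} {q} ∣p∣≡∣q∣ p⊆q∪x with m≤n⇒m<n∨m≡n (p⊆q∪⁅x⁆⇒∣p─q∣≤1 p⊆q∪x)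
... | inj₂ ∣p─q∣≡1 = [ ∣p∣≡∣q∣ , ∣p─q∣≡1 ]
... | inj₁ ∣p─q∣<1 = Refl.reflexive (⊆-antisym (∣p─q∣≡0⇒p⊆q p q ∣p─q∣≡0) (∣p─q∣≡0⇒p⊆q q p ∣q─p∣≡0))
  where
  ∣p─q∣≡0 = n<1⇒n≡0 ∣p─q∣<1
  ∣q─p∣≡0 = trans (sym (∣p∣≡∣q∣⇒∣p─q∣≡∣q─p∣ p q ∣p∣≡∣q∣)) ∣p─q∣≡0

p∪⁅x⁆≡q∪⁅y⁆⇒∣p∣≡∣q∣ : ∀ (p q : Subset n) → x ∉ p → y ∉ q → p ∪ ⁅ x ⁆ ≡ q ∪ ⁅ y ⁆ → ∣ p ∣ ≡ ∣ q ∣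
p∪⁅x⁆≡q∪⁅y⁆⇒∣p∣≡∣q∣ p q x∉p y∉q eq = suc-injective (begin
  suc ∣ p ∣       ≡⟨ sym (x∉p⇒∣p∪⁅x⁆∣≡1+∣p∣ p x∉p) ⟩
  ∣ p ∪ ⁅ _ ⁆ ∣   ≡⟨ cong ∣_∣ eq ⟩
  ∣ q ∪ ⁅ _ ⁆ ∣   ≡⟨ x∉p⇒∣p∪⁅x⁆∣≡1+∣p∣ q y∉q ⟩
  suc ∣ q ∣       ∎)
  where open ≡-Reasoning

p∪⁅x⁆≡q∪⁅y⁆⇒TJStep⁼ : x ∉ p → y ∉ q → p ∪ ⁅ x ⁆ ≡ q ∪ ⁅ y ⁆ → TJStep⁼ p q
p∪⁅x⁆≡q∪⁅y⁆⇒TJStep⁼ {p = p} {q = q} x∉p y∉q eq =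
  p⊆q∪⁅x⁆⇒TJStep⁼ (p∪⁅x⁆≡q∪⁅y⁆⇒∣p∣≡∣q∣ p q x∉p y∉q eq) (subst (_ ∈_) eq ∘ p⊆p∪q _)

p∪⁅x⁆-TJStep⁼-p∪⁅y⁆ : x ∉ p → y ∉ p → TJStep⁼ (p ∪ ⁅ x ⁆) (p ∪ ⁅ y ⁆)
p∪⁅x⁆-TJStep⁼-p∪⁅y⁆ {p = p} x∉p y∉p = p⊆q∪⁅x⁆⇒TJStep⁼
  (trans (x∉p⇒∣p∪⁅x⁆∣≡1+∣p∣ p x∉p) (sym (x∉p⇒∣p∪⁅x⁆∣≡1+∣p∣ p y∉p)))
  (x∈p∪q⁺ ∘ Sum.map₁ (x∈p∪q⁺ ∘ inj₁) ∘ x∈p∪q⁻ p _)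

record Jump {n} (A B : Subset n) : Set where
  field
    source target     : Fin n
    source∉B          : source ∉ B
    target∈B          : target ∈ B
    target∉A          : target ∉ A
    A∪target≡B∪source : A ∪ ⁅ target ⁆ ≡ B ∪ ⁅ source ⁆

TJStep⇒Jump : ∀ (A B : Subset n) → TJStep A B → Jump A B
TJStep⇒Jump A B (∣A∣≡∣B∣ , ∣A─B∣≡1)
  with ∣p∣≡1⇒p≡⁅x⁆ ∣A─B∣≡1 | ∣p∣≡1⇒p≡⁅x⁆ (trans (sym (∣p∣≡∣q∣⇒∣p─q∣≡∣q─p∣ A B ∣A∣≡∣B∣)) ∣A─B∣≡1)
... | x , A─B≡⁅x⁆ | y , B─A≡⁅y⁆ = record
  { source            = x
  ; target            = y
  ; source∉B          = x∈p─q⇒x∉q A B x∈A─B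
  ; target∈B          = p─q⊆p B A y∈B─A
  ; target∉A          = x∈p─q⇒x∉q B A y∈B─A
  ; A∪target≡B∪source = begin
      A ∪ ⁅ y ⁆   ≡⟨ cong (A ∪_) (sym B─A≡⁅y⁆) ⟩
      A ∪ (B ─ A) ≡⟨ p∪[q─p]≡p∪q A B ⟩
      A ∪ B       ≡⟨ ∪-comm A B ⟩
      B ∪ A       ≡⟨ sym (p∪[q─p]≡p∪q B A) ⟩
      B ∪ (A ─ B) ≡⟨ cong (B ∪_) A─B≡⁅x⁆ ⟩
      B ∪ ⁅ x ⁆   ∎
  }
  where
  open ≡-Reasoning
  x∈A─B = subst (x ∈_) (sym A─B≡⁅x⁆) (x∈⁅x⁆ x)
  y∈B─A = subst (y ∈_) (sym B─A≡⁅y⁆) (x∈⁅x⁆ y)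

start-satisfies : Seq R P A B m → P A
start-satisfies (single pA)   = pA
start-satisfies (step pA _ _) = pA

infixr 5 _++_
_++_ : ∀ {m′} → Seq R P A B m → Seq R P B C (suc m′) → Seq R P A C (m + m′)
single _        ++ s = s
step pA r rest  ++ s = step pA r (rest ++ s)

Seq-dropRefl : Seq (ReflClosure R) P A B m → ∃[ m′ ] m′ ≤ m × Seq R P A B m′
Seq-dropRefl (single pA) = 1 , ≤-refl , single pA
Seq-dropRefl (step _ Refl.refl rest) = map₂ (map₁ m≤n⇒m≤1+n) (Seq-dropRefl rest)
Seq-dropRefl (step pA [ r ] rest) with Seq-dropRefl rest
... | m′ , m′≤m , s = suc m′ , s≤s m′≤m , step pA r s

TJSeq⁼ : (Subset n → Set) → Subset n → Subset n → ℕ → Set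
TJSeq⁼ X = Seq TJStep⁼ X

module _ {n} {X : Subset n → Set} where

  record FirstArrival (t j : ℕ) (U T : Subset n) (m : ℕ) : Set where
    constructor arrival
    field
      {m₁ m₂}    : ℕ
      {last}     : Subset n
      {added}    : Fin n
      added∉last : added ∉ last
      1+∣last∣≡j : suc ∣ last ∣ ≡ j
      before     : TARSeq X j U last m₁
      after      : TARSeq X t (last ∪ ⁅ added ⁆) T m₂
      m₁+m₂≡m    : m₁ + m₂ ≡ m

  arrival-cons : X A × ∣ A ∣ ≤ j → TARStep A B → FirstArrival t j B T m → FirstArrival t j A T (suc m)
  arrival-cons pA r (arrival b∉last size before after refl) =
    arrival b∉last size (step pA r before) after refl

  firstArrival : ∀ {t U} → ∣ U ∣ < j → ∣ T ∣ ≡ j → TARSeq X t U T m → FirstArrival t j U T m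
  firstArrival ∣U∣<j ∣T∣≡j (single _) = contradiction ∣T∣≡j (<⇒≢ ∣U∣<j)
  firstArrival {j = j} {U = U} ∣U∣<j ∣T∣≡j (step (xU , _) (add (v , v∉U , refl)) rest) with suc ∣ U ∣ ≟ j
  ... | yes 1+∣U∣≡j = arrival v∉U 1+∣U∣≡j (single (xU , <⇒≤ ∣U∣<j)) rest refl
  ... | no  1+∣U∣≢j = arrival-cons (xU , <⇒≤ ∣U∣<j) (add (v , v∉U , refl)) (firstArrival ∣U∪v∣<j ∣T∣≡j rest)
    where
    ∣U∪v∣<j = subst (_< j) (sym (x∉p⇒∣p∪⁅x⁆∣≡1+∣p∣ U v∉U)) (≤∧≢⇒< ∣U∣<j 1+∣U∣≢j)
  firstArrival {j = j} ∣U∣<j ∣T∣≡j (step {B = B} (xU , _) (remove (v , v∉B , refl)) rest) =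
    arrival-cons (xU , <⇒≤ ∣U∣<j) (remove (v , v∉B , refl)) (firstArrival ∣B∣<j ∣T∣≡j rest)
    where
    ∣B∣<j = ≤-<-trans (n≤1+n _) (subst (_< j) (x∉p⇒∣p∪⁅x⁆∣≡1+∣p∣ B v∉B) ∣U∣<j)

2*r<m⇒2*[1+r]<2+m : ∀ {r} → 2 * r < m → 2 * suc r < 2 + m
2*r<m⇒2*[1+r]<2+m {m} {r} 2r<m = subst (_< 2 + m) (sym (*-suc 2 r)) (+-monoʳ-< 2 2r<m)

2*[1+r₁+r₂]<1+m₁+m₂ : ∀ r₁ r₂ {m₁ m₂} → 2 * r₁ < m₁ → 2 * r₂ < m₂ → 2 * suc (r₁ + r₂) < suc (m₁ + m₂)
2*[1+r₁+r₂]<1+m₁+m₂ r₁ r₂ {m₁} {m₂} 2r₁<m₁ 2r₂<m₂ = s≤s (begin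
  2 * suc (r₁ + r₂)           ≡⟨ distribute r₁ r₂ ⟩
  suc (2 * r₁) + suc (2 * r₂) ≤⟨ +-mono-≤ 2r₁<m₁ 2r₂<m₂ ⟩
  m₁ + m₂                     ∎)
  where
  open ≤-Reasoning
  distribute : ∀ r₁ r₂ → 2 * suc (r₁ + r₂) ≡ suc (2 * r₁) + suc (2 * r₂)
  distribute = solve-∀

module _ {n} {X : Subset n → Set} (mono : MonotoneIncreasing X) where

  TJSeq⇒TARSeq : ∣ A ∣ ≡ k → TJSeq X A B m → ∃[ m′ ] m′ ≤ 2 * m × TARSeq X (suc k) A B m′
  TJSeq⇒TARSeq {k = k} ∣A∣≡k (single xA) =
    1 , s≤s z≤n , single (xA , ≤-trans (≤-reflexive ∣A∣≡k) (n≤1+n k))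
  TJSeq⇒TARSeq {A = A} {k = k} {m = suc m} ∣A∣≡k (step {B = B} xA tj rest)
    with TJSeq⇒TARSeq (trans (sym (proj₁ tj)) ∣A∣≡k) rest
  ... | m′ , m′≤2m , tar =
    2 + m′ ,
    subst (2 + m′ ≤_) (sym (*-suc 2 m)) (+-monoʳ-≤ 2 m′≤2m) ,
    step (xA , ≤-trans (≤-reflexive ∣A∣≡k) (n≤1+n k)) (add (target , target∉A , refl))
      (step (mono A B xA (start-satisfies rest) tj target target∈B target∉A ,
             ≤-reflexive ∣A∪target∣≡1+k)
            (remove (source , source∉B , A∪target≡B∪source)) tar)
    where
    open Jump (TJStep⇒Jump A B tj)
    ∣A∪target∣≡1+k = trans (x∉p⇒∣p∪⁅x⁆∣≡1+∣p∣ A target∉A) (cong suc ∣A∣≡k)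

  -- The extra token first jumps onto the target of each jump of the sequence,
  -- and thereby takes over the role of that jump's source.
  addToken : ∀ {P Q r a b} → TJSeq⁼ X P Q r → a ∉ P → b ∉ Q → X (P ∪ ⁅ a ⁆) → X (Q ∪ ⁅ b ⁆) →
             TJSeq⁼ X (P ∪ ⁅ a ⁆) (Q ∪ ⁅ b ⁆) (suc r)
  addToken (single _) a∉P b∉P xP∪a xP∪b = step xP∪a (p∪⁅x⁆-TJStep⁼-p∪⁅y⁆ a∉P b∉P) (single xP∪b)
  addToken (step _ Refl.refl rest) a∉P b∉Q xP∪a xQ∪b =
    step xP∪a Refl.refl (addToken rest a∉P b∉Q xP∪a xQ∪b)
  addToken {P = P} (step {B = P₁} xP [ tj ] rest) a∉P b∉Q xP∪a xQ∪b =
    step xP∪a (p∪⁅x⁆-TJStep⁼-p∪⁅y⁆ a∉P target∉A)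
      (subst (λ Z → TJSeq⁼ X Z _ _) (sym A∪target≡B∪source)
        (addToken rest source∉B b∉Q X[P₁∪source] xQ∪b))
    where
    open Jump (TJStep⇒Jump P P₁ tj)
    X[P₁∪source] : X (P₁ ∪ ⁅ source ⁆)
    X[P₁∪source] =
      subst X A∪target≡B∪source (mono P P₁ xP (start-satisfies rest) tj target target∈B target∉A)

  -- Lengths count sets, so 2 * r < m says that the r jumps use at least 2 r of
  -- the m - 1 TAR steps.
  TARSeq⇒TJSeq⁼ : ∣ S ∣ ≡ j → ∣ T ∣ ≡ j → TARSeq X (suc j) S T m → ∃[ r ] 2 * r < m × TJSeq⁼ X S T (suc r)
  TARSeq⇒TJSeq⁼ = go (<-wellFounded _)
    where
    go : ∀ {S T j m} → Acc _<_ m → ∣ S ∣ ≡ j → ∣ T ∣ ≡ j → TARSeq X (suc j) S T m →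
         ∃[ r ] 2 * r < m × TJSeq⁼ X S T (suc r)
    go _ _ _ (single (xS , _)) = 0 , s≤s z≤n , single xS
    go {S} _ ∣S∣≡j ∣T∣≡j (step _ (add (v , v∉S , refl)) (single _)) =
      contradiction (trans (sym (x∉p⇒∣p∪⁅x⁆∣≡1+∣p∣ S v∉S)) (trans ∣T∣≡j (sym ∣S∣≡j))) 1+n≢n
    go {S} {j = j} _ ∣S∣≡j _ (step _ (add (v , v∉S , refl)) (step _ (add (w , w∉S∪v , refl)) rest)) =
      contradiction (subst (_≤ suc j) ∣S∪v∪w∣≡2+j (proj₂ (start-satisfies rest))) 1+n≰n
      where
      ∣S∪v∪w∣≡2+j = trans (x∉p⇒∣p∪⁅x⁆∣≡1+∣p∣ (S ∪ ⁅ v ⁆) w∉S∪v)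
                          (cong suc (trans (x∉p⇒∣p∪⁅x⁆∣≡1+∣p∣ S v∉S) (cong suc ∣S∣≡j)))
    go {S} (acc rec) ∣S∣≡j ∣T∣≡j
       (step (xS , _) (add (v , v∉S , refl)) (step {B = W} _ (remove (u , u∉W , S∪v≡W∪u)) rest))
      with go (rec (s≤s (n≤1+n _)))
              (trans (sym (p∪⁅x⁆≡q∪⁅y⁆⇒∣p∣≡∣q∣ S W v∉S u∉W S∪v≡W∪u)) ∣S∣≡j) ∣T∣≡j rest
    ... | r , 2r<m , tj⁼ =
      suc r , 2*r<m⇒2*[1+r]<2+m 2r<m , step xS (p∪⁅x⁆≡q∪⁅y⁆⇒TJStep⁼ v∉S u∉W S∪v≡W∪u) tj⁼
    go {j = zero} _ ∣S∣≡0 _ (step {B = U} _ (remove (a , a∉U , refl)) _) =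
      contradiction (trans (sym (x∉p⇒∣p∪⁅x⁆∣≡1+∣p∣ U a∉U)) ∣S∣≡0) 1+n≢0
    go {j = suc i} (acc rec) ∣S∣≡1+i ∣T∣≡1+i (step {B = U} (xS , _) (remove (a , a∉U , refl)) rest)
      with trans (sym (x∉p⇒∣p∪⁅x⁆∣≡1+∣p∣ U a∉U)) ∣S∣≡1+i
    ... | 1+∣U∣≡1+i with firstArrival (≤-reflexive 1+∣U∣≡1+i) ∣T∣≡1+i rest
    ... | arrival {m₁} {m₂} {U′} b∉U′ 1+∣U′∣≡1+i before after refl
      with go (rec (s≤s (m≤m+n m₁ m₂))) (suc-injective 1+∣U∣≡1+i) (suc-injective 1+∣U′∣≡1+i) before
         | go (rec (s≤s (m≤n+m m₂ m₁))) (trans (x∉p⇒∣p∪⁅x⁆∣≡1+∣p∣ U′ b∉U′) 1+∣U′∣≡1+i) ∣T∣≡1+i after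
    ... | r₁ , 2r₁<m₁ , tj₁ | r₂ , 2r₂<m₂ , tj₂ =
      suc (r₁ + r₂) , 2*[1+r₁+r₂]<1+m₁+m₂ r₁ r₂ 2r₁<m₁ 2r₂<m₂ ,
      addToken tj₁ a∉U b∉U′ xS (proj₁ (start-satisfies after)) ++ tj₂

theorem3 : (n : ℕ) (G : Graph n) (X : Subset n → Set) → MonotoneIncreasing X →
           (As At : Subset n) (k ℓ : ℕ) → X As → X At → ∣ As ∣ ≡ k → ∣ At ∣ ≡ k →
           (Σ ℕ λ m → (m ≤ ℓ) × TJSeq X As At m)
             ⇔ (Σ ℕ λ m → (m ≤ 2 * ℓ) × TARSeq X (k + 1) As At m)
theorem3 n _ X mono As At k ℓ _ _ ∣As∣≡k ∣At∣≡k = mk⇔ TJ⇒TAR TAR⇒TJ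
  where
  threshold : suc k ≡ k + 1
  threshold = +-comm 1 k

  TJ⇒TAR : (Σ ℕ λ m → (m ≤ ℓ) × TJSeq X As At m) → Σ ℕ λ m → (m ≤ 2 * ℓ) × TARSeq X (k + 1) As At m
  TJ⇒TAR (m , m≤ℓ , tj) with TJSeq⇒TARSeq mono ∣As∣≡k tj
  ... | m′ , m′≤2m , tar =
    m′ , ≤-trans m′≤2m (*-monoʳ-≤ 2 m≤ℓ) , subst (λ t → TARSeq X t As At m′) threshold tar

  TAR⇒TJ : (Σ ℕ λ m → (m ≤ 2 * ℓ) × TARSeq X (k + 1) As At m) → Σ ℕ λ m → (m ≤ ℓ) × TJSeq X As At m
  TAR⇒TJ (m , m≤2ℓ , tar)
    with TARSeq⇒TJSeq⁼ mono ∣As∣≡k ∣At∣≡k (subst (λ t → TARSeq X t As At m) (sym threshold) tar)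
  ... | r , 2r<m , tj⁼ with Seq-dropRefl tj⁼
  ... | m′ , m′≤1+r , tj = m′ , ≤-trans m′≤1+r (*-cancelˡ-< 2 r ℓ (<-≤-trans 2r<m m≤2ℓ)) , tj
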